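{- Let $G$ and $H$ be simple hypergraphs with $r(G)=2$ and $r(H)\leq 3$. Then $G\,\widehat{\times}\,H = G\,\widetilde{\times}\,H$, i.e. these two products have the same vertex set and the same edge set.
   Context: A (finite) hypergraph $H=(V,E)$ consists of a finite vertex set $V$ and a collection $E$ of non-empty subsets of $V$ (edges). The rank is $r(H)=\max_{e\in E}|e|$. A hypergraph is simple if no edge is contained in any other edge and each edge contains at least two vertices. For hypergraphs $H_1=(V_1,E_1)$, $H_2=(V_2,E_2)$, both products below have vertex set $V_1\times V_2$; $p_i$ denotes the projection onto the $i$-th coordinate. Maximal rank preserving direct product $H_1\,\widehat{\times}\,H_2$: for $e_1\in E_1,e_2\in E_2$ let $r^{+}_{e_1,e_2}=\max\{|e_1|,|e_2|\}$; the edges are all subsets $e\subseteq e_1\times e_2$ with $e_1\in E_1$, $e_2\in E_2$, $|e|=r^{+}_{e_1,e_2}$ and $p_i(e)=e_i$ for $i=1,2$. Non-rank-preserving direct product $H_1\,\widetilde{\times}\,H_2$: its edge set is $\{\{(x,y)\}\cup((e\setminus\{x\})\times(f\setminus\{y\})) : x\in e\in E_1,\ y\in f\in E_2\}$. -}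

module Defs where

open import Data.Nat using (ℕ; _≤_; _⊔_; _≥_)
open import Data.Bool using (Bool; true; false; _∨_; if_then_else_)
open import Data.Fin using (Fin)
open import Data.Fin.Subset using (Subset; _∈_; _⊆_; _∩_; _∪_; ∁; ⁅_⁆; ⊥; ∣_∣; Nonempty)
open import Data.Vec as Vec using (Vec; lookup; tabulate; zipWith)
open import Data.List as List using (List)
import Data.List.Membership.Propositional as LM
open import Data.Product using (Σ; ∃; _×_; _,_)
open import Relation.Binary.PropositionalEquality using (_≡_)
open import Relation.Nullary using (does)
open import Data.Fin using (_≟_)

record Hypergraph (n : ℕ) : Set where
  field
    edges    : List (Subset n)
    nonempty : ∀ {e} → e LM.∈ edges → Nonempty e
open Hypergraph public

_∈E_ : ∀ {n} → Subset n → Hypergraph n → Set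
e ∈E H = e LM.∈ edges H

rank : ∀ {n} → Hypergraph n → ℕ
rank H = List.foldr (λ e r → ∣ e ∣ ⊔ r) 0 (edges H)

Simple : ∀ {n} → Hypergraph n → Set
Simple H = (∀ {e} → e ∈E H → ∣ e ∣ ≥ 2)
         × (∀ {e f} → e ∈E H → f ∈E H → e ⊆ f → e ≡ f)

-- Subsets of the product vertex set Fin n × Fin m, encoded as a vector
-- of rows: (x , y) ∈ S  iff  y ∈ lookup S x.

PSub : ℕ → ℕ → Set
PSub n m = Vec (Subset m) n

_∈P_ : ∀ {n m} → Fin n × Fin m → PSub n m → Set
(x , y) ∈P S = y ∈ lookup S x

_⊆P_ : ∀ {n m} → PSub n m → PSub n m → Set
S ⊆P T = ∀ {x y} → (x , y) ∈P S → (x , y) ∈P T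

∣_∣P : ∀ {n m} → PSub n m → ℕ
∣ S ∣P = Vec.sum (Vec.map ∣_∣ S)

_∪P_ : ∀ {n m} → PSub n m → PSub n m → PSub n m
S ∪P T = zipWith _∪_ S T

_×P_ : ∀ {n m} → Subset n → Subset m → PSub n m
A ×P B = tabulate λ i → if lookup A i then B else ⊥

⁅_,_⁆P : ∀ {n m} → Fin n → Fin m → PSub n m
⁅ x , y ⁆P = tabulate λ i → if does (i ≟ x) then ⁅ y ⁆ else ⊥

rowNonempty : ∀ {m} → Subset m → Bool
rowNonempty = Vec.foldr _ _∨_ false

p₁ : ∀ {n m} → PSub n m → Subset n
p₁ S = Vec.map rowNonempty S

p₂ : ∀ {n m} → PSub n m → Subset m
p₂ S = Vec.foldr _ _∪_ ⊥ S

_∖⁅_⁆ : ∀ {n} → Subset n → Fin n → Subset n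
e ∖⁅ x ⁆ = e ∩ ∁ ⁅ x ⁆

HatEdge : ∀ {n m} → Hypergraph n → Hypergraph m → PSub n m → Set
HatEdge H₁ H₂ e =
  Σ (Subset _) λ e₁ → Σ (Subset _) λ e₂ →
    e₁ ∈E H₁ × e₂ ∈E H₂ × e ⊆P (e₁ ×P e₂)
    × ∣ e ∣P ≡ ∣ e₁ ∣ ⊔ ∣ e₂ ∣ × p₁ e ≡ e₁ × p₂ e ≡ e₂

TildeEdge : ∀ {n m} → Hypergraph n → Hypergraph m → PSub n m → Set
TildeEdge H₁ H₂ e =
  Σ (Subset _) λ e₁ → Σ (Subset _) λ f → Σ (Fin _) λ x → Σ (Fin _) λ y →
    e₁ ∈E H₁ × f ∈E H₂ × x ∈ e₁ × y ∈ f
    × e ≡ (⁅ x , y ⁆P ∪P ((e₁ ∖⁅ x ⁆) ×P (f ∖⁅ y ⁆)))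

-- Every edge of G is a pair {x, x'}. An edge e of G ×̂ H over e₁ = {x, x'} and
-- e₂ ∈ H has only the two rows x and x', both non-empty, of total size |e₂| ≤ 3;
-- hence one of them, say row x, is a singleton {y}. The other row covers e₂ ∖ {y}
-- and has exactly |e₂| - 1 elements, so it is e₂ ∖ {y}, which is the shape of the
-- edge of G ×̃ H built from x ∈ e₁ and y ∈ e₂. Conversely that edge has rows {y}
-- and e₂ ∖ {y}, so its size is |e₂| = max(2, |e₂|) and its projections are e₁, e₂.
module Submission where

open import Defs
open import Data.Bool using (Bool; true; false; if_then_else_; _∧_; not)
open import Data.Bool.Properties using (¬-not; ∧-identityʳ)
open import Data.Empty using (⊥-elim)
open import Data.Fin using (Fin; zero; suc; _≟_)
open import Data.Fin.Properties using (suc-injective)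
open import Data.Fin.Subset using (Subset; _∈_; _∉_; _⊆_; _∩_; _∪_; ∁; ⁅_⁆; ⊥; ∣_∣; Nonempty)
open import Data.Fin.Subset.Properties
open import Data.List using (List; _∷_; foldr)
import Data.List.Membership.Propositional as List
open import Data.List.Relation.Unary.Any using () renaming (here to hereᴸ; there to thereᴸ)
open import Data.Nat using (ℕ; zero; suc; _+_; _⊔_; _≤_; _<_; s≤s; z≤n)
import Data.Nat.Properties as ℕ
open import Data.Product using (_×_; _,_; ∃; proj₁; proj₂)
open import Data.Sum using (_⊎_; inj₁; inj₂; [_,_]′)
open import Data.Vec using (Vec; []; _∷_; lookup; here; there)
open import Data.Vec.Properties
  using (lookup-map; lookup-zipWith; lookup∘tabulate; tabulate∘lookup; tabulate-cong; []=⇒lookup; lookup⇒[]=)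
open import Function using (_∘_)
open import Relation.Binary.PropositionalEquality
open import Relation.Nullary using (does; yes; no)
open import Relation.Nullary.Decidable using (dec-true; dec-false)

private
  variable
    n m : ℕ

∉⇒lookup≡false : {x : Fin n} {p : Subset n} → x ∉ p → lookup p x ≡ false
∉⇒lookup≡false {x = x} {p} x∉p = ¬-not (x∉p ∘ lookup⇒[]= x p)

∣p∣≡0⇒p≡⊥ : (p : Subset n) → ∣ p ∣ ≡ 0 → p ≡ ⊥
∣p∣≡0⇒p≡⊥ []          _       = refl
∣p∣≡0⇒p≡⊥ (false ∷ p) ∣p∣≡0 = cong (false ∷_) (∣p∣≡0⇒p≡⊥ p ∣p∣≡0)

∣p∣≡1⇒singleton : (p : Subset n) → ∣ p ∣ ≡ 1 → ∃ λ x → p ≡ ⁅ x ⁆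
∣p∣≡1⇒singleton (true ∷ p) ∣p∣≡1 = zero , cong (true ∷_) (∣p∣≡0⇒p≡⊥ p (ℕ.suc-injective ∣p∣≡1))
∣p∣≡1⇒singleton (false ∷ p) ∣p∣≡1 =
  let x , p≡⁅x⁆ = ∣p∣≡1⇒singleton p ∣p∣≡1 in suc x , cong (false ∷_) p≡⁅x⁆

Nonempty⇒∣p∣>0 : {p : Subset n} → Nonempty p → 0 < ∣ p ∣
Nonempty⇒∣p∣>0 {p = true ∷ p}  _                 = s≤s z≤n
Nonempty⇒∣p∣>0 {p = false ∷ p} (suc x , there x∈p) = Nonempty⇒∣p∣>0 (x , x∈p)

∣p∣>0⇒Nonempty : (p : Subset n) → 0 < ∣ p ∣ → Nonempty p
∣p∣>0⇒Nonempty (true ∷ p)  _       = zero , here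
∣p∣>0⇒Nonempty (false ∷ p) ∣p∣>0 = let x , x∈p = ∣p∣>0⇒Nonempty p ∣p∣>0 in suc x , there x∈p

p⊆q∧∣q∣≤∣p∣⇒p≡q : {p q : Subset n} → p ⊆ q → ∣ q ∣ ≤ ∣ p ∣ → p ≡ q
p⊆q∧∣q∣≤∣p∣⇒p≡q {p = []}          {[]}          _   _        = refl
p⊆q∧∣q∣≤∣p∣⇒p≡q {p = false ∷ p} {false ∷ q} p⊆q ∣q∣≤∣p∣ =
  cong (false ∷_) (p⊆q∧∣q∣≤∣p∣⇒p≡q (drop-∷-⊆ p⊆q) ∣q∣≤∣p∣)
p⊆q∧∣q∣≤∣p∣⇒p≡q {p = false ∷ p} {true ∷ q}  p⊆q ∣q∣<∣p∣ =
  ⊥-elim (ℕ.<-irrefl refl (ℕ.<-≤-trans ∣q∣<∣p∣ (p⊆q⇒∣p∣≤∣q∣ (drop-∷-⊆ p⊆q))))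
p⊆q∧∣q∣≤∣p∣⇒p≡q {p = true ∷ p}  {false ∷ q} p⊆q _ with p⊆q here
... | ()
p⊆q∧∣q∣≤∣p∣⇒p≡q {p = true ∷ p}  {true ∷ q}  p⊆q (s≤s ∣q∣≤∣p∣) =
  cong (true ∷_) (p⊆q∧∣q∣≤∣p∣⇒p≡q (drop-∷-⊆ p⊆q) ∣q∣≤∣p∣)

∈∖⁅⁆⁺ : {p : Subset n} {i x : Fin n} → i ∈ p → i ≢ x → i ∈ p ∖⁅ x ⁆
∈∖⁅⁆⁺ i∈p i≢x = x∈p∩q⁺ (i∈p , x∉p⇒x∈∁p (x≢y⇒x∉⁅y⁆ i≢x))

∈∖⁅⁆⁻ : {p : Subset n} {i x : Fin n} → i ∈ p ∖⁅ x ⁆ → i ∈ p × i ≢ x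
∈∖⁅⁆⁻ {p = p} {x = x} i∈p∖x =
  let i∈p , i∈∁x = x∈p∩q⁻ p (∁ ⁅ x ⁆) i∈p∖x
  in i∈p , λ { refl → x∈∁p⇒x∉p i∈∁x (x∈⁅x⁆ x) }

∣p∣≡1+∣p∖x∣ : {p : Subset n} {x : Fin n} → x ∈ p → ∣ p ∣ ≡ suc ∣ p ∖⁅ x ⁆ ∣
∣p∣≡1+∣p∖x∣ {p = true ∷ p}  {zero}  here        = cong (suc ∘ ∣_∣) (sym p∩∁⊥≡p)
  where
  p∩∁⊥≡p : p ∩ ∁ ⊥ ≡ p
  p∩∁⊥≡p = ⊆-antisym (p∩q⊆p p (∁ ⊥)) (λ i∈p → x∈p∩q⁺ (i∈p , x∉p⇒x∈∁p ∉⊥))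
∣p∣≡1+∣p∖x∣ {p = true ∷ p}  {suc x} (there x∈p) = cong suc (∣p∣≡1+∣p∖x∣ x∈p)
∣p∣≡1+∣p∖x∣ {p = false ∷ p} {suc x} (there x∈p) = ∣p∣≡1+∣p∖x∣ x∈p

record Pair (p : Subset n) (x : Fin n) : Set where
  field
    other       : Fin n
    other≢x     : other ≢ x
    p∖x≡⁅other⁆ : p ∖⁅ x ⁆ ≡ ⁅ other ⁆

  other∈p : other ∈ p
  other∈p = proj₁ (∈∖⁅⁆⁻ (subst (other ∈_) (sym p∖x≡⁅other⁆) (x∈⁅x⁆ other)))

  ∉-pair : {i : Fin n} → i ≢ x → i ≢ other → i ∉ p
  ∉-pair i≢x i≢other i∈p = i≢other (x∈⁅y⁆⇒x≡y other (subst (_ ∈_) p∖x≡⁅other⁆ (∈∖⁅⁆⁺ i∈p i≢x)))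

∣p∣≡2⇒Pair : {p : Subset n} {x : Fin n} → ∣ p ∣ ≡ 2 → x ∈ p → Pair p x
∣p∣≡2⇒Pair {p = p} {x} ∣p∣≡2 x∈p = record
  { other       = x'
  ; other≢x     = proj₂ (∈∖⁅⁆⁻ (subst (x' ∈_) (sym p∖x≡⁅x'⁆) (x∈⁅x⁆ x')))
  ; p∖x≡⁅other⁆ = p∖x≡⁅x'⁆
  }
  where
  ∣p∖x∣≡1 : ∣ p ∖⁅ x ⁆ ∣ ≡ 1
  ∣p∖x∣≡1 = ℕ.suc-injective (trans (sym (∣p∣≡1+∣p∖x∣ x∈p)) ∣p∣≡2)
  x' : Fin _
  x' = proj₁ (∣p∣≡1⇒singleton (p ∖⁅ x ⁆) ∣p∖x∣≡1)
  p∖x≡⁅x'⁆ : p ∖⁅ x ⁆ ≡ ⁅ x' ⁆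
  p∖x≡⁅x'⁆ = proj₂ (∣p∣≡1⇒singleton (p ∖⁅ x ⁆) ∣p∖x∣≡1)

∈-if⁻ : {b : Bool} {A : Subset n} {j : Fin n} → j ∈ (if b then A else ⊥) → b ≡ true × j ∈ A
∈-if⁻ {b = true}  j∈A = refl , j∈A
∈-if⁻ {b = false} j∈⊥ = ⊥-elim (∉⊥ j∈⊥)

lookup-ext : {A : Set} (u v : Vec A n) → (∀ i → lookup u i ≡ lookup v i) → u ≡ v
lookup-ext u v u≗v = trans (sym (tabulate∘lookup u)) (trans (tabulate-cong u≗v) (tabulate∘lookup v))

lookup-×P : (A : Subset n) (B : Subset m) (i : Fin n) → lookup (A ×P B) i ≡ (if lookup A i then B else ⊥)
lookup-×P A B i = lookup∘tabulate _ i

∈×P⁺ : {A : Subset n} {B : Subset m} {i : Fin n} {j : Fin m} → i ∈ A → j ∈ B → (i , j) ∈P (A ×P B)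
∈×P⁺ {A = A} {B} {i} i∈A j∈B =
  subst (_ ∈_) (sym (trans (lookup-×P A B i) (cong (if_then B else ⊥) ([]=⇒lookup i∈A)))) j∈B

∈×P⁻ : (A : Subset n) (B : Subset m) {i : Fin n} {j : Fin m} → (i , j) ∈P (A ×P B) → i ∈ A × j ∈ B
∈×P⁻ A B {i} ij∈A×B =
  let A[i] , j∈B = ∈-if⁻ (subst (_ ∈_) (lookup-×P A B i) ij∈A×B) in lookup⇒[]= i A A[i] , j∈B

row-outside : {S : PSub n m} (A : Subset n) (B : Subset m) {i : Fin n} →
              S ⊆P (A ×P B) → i ∉ A → lookup S i ≡ ⊥
row-outside A B {i} S⊆A×B i∉A = Empty-unique λ (j , j∈) → i∉A (proj₁ (∈×P⁻ A B (S⊆A×B {i} j∈)))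

rowNonempty⁺ : {r : Subset m} → Nonempty r → rowNonempty r ≡ true
rowNonempty⁺ {r = true ∷ r}  _                 = refl
rowNonempty⁺ {r = false ∷ r} (suc j , there j∈r) = rowNonempty⁺ (j , j∈r)

rowNonempty⁻ : (r : Subset m) → rowNonempty r ≡ true → Nonempty r
rowNonempty⁻ (true ∷ r)  _        = zero , here
rowNonempty⁻ (false ∷ r) nonempty = let j , j∈r = rowNonempty⁻ r nonempty in suc j , there j∈r

rowNonempty-if : {r : Subset m} → Nonempty r → (b : Bool) → rowNonempty (if b then r else ⊥) ≡ b
rowNonempty-if r≢∅ true  = rowNonempty⁺ r≢∅
rowNonempty-if {m = m} r≢∅ false = ¬-not (λ ⊥≢∅ → ∉⊥ (proj₂ (rowNonempty⁻ (⊥ {m}) ⊥≢∅)))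

p₂⁺ : (S : PSub n m) {j : Fin m} (i : Fin n) → j ∈ lookup S i → j ∈ p₂ S
p₂⁺ (r ∷ S) zero    j∈r    = x∈p∪q⁺ (inj₁ j∈r)
p₂⁺ (r ∷ S) (suc i) j∈S[i] = x∈p∪q⁺ {p = r} (inj₂ (p₂⁺ S i j∈S[i]))

p₂⁻ : (S : PSub n m) {j : Fin m} → j ∈ p₂ S → ∃ λ i → j ∈ lookup S i
p₂⁻ []      j∈⊥ = ⊥-elim (∉⊥ j∈⊥)
p₂⁻ (r ∷ S) j∈r∪p₂S with x∈p∪q⁻ r (p₂ S) j∈r∪p₂S
... | inj₁ j∈r   = zero , j∈r
... | inj₂ j∈p₂S = let i , j∈S[i] = p₂⁻ S j∈p₂S in suc i , j∈S[i]

p₂-⊆ : {S : PSub n m} (A : Subset n) (B : Subset m) → S ⊆P (A ×P B) → p₂ S ⊆ B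
p₂-⊆ {S = S} A B S⊆A×B j∈p₂S = let i , j∈S[i] = p₂⁻ S j∈p₂S in proj₂ (∈×P⁻ A B (S⊆A×B {i} j∈S[i]))

∣S∣P≡0 : (S : PSub n m) → (∀ i → lookup S i ≡ ⊥) → ∣ S ∣P ≡ 0
∣S∣P≡0 []      _     = refl
∣S∣P≡0 {m = m} (r ∷ S) empty = cong₂ _+_ (trans (cong ∣_∣ (empty zero)) (∣⊥∣≡0 m)) (∣S∣P≡0 S (empty ∘ suc))

∣S∣P≡∣row∣ : (S : PSub n m) (x : Fin n) → (∀ i → i ≢ x → lookup S i ≡ ⊥) → ∣ S ∣P ≡ ∣ lookup S x ∣
∣S∣P≡∣row∣ (r ∷ S) zero    empty =
  trans (cong (∣ r ∣ +_) (∣S∣P≡0 S λ i → empty (suc i) λ ())) (ℕ.+-identityʳ _)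
∣S∣P≡∣row∣ {m = m} (r ∷ S) (suc x) empty =
  cong₂ _+_ (trans (cong ∣_∣ (empty zero λ ())) (∣⊥∣≡0 m))
            (∣S∣P≡∣row∣ S x λ i i≢x → empty (suc i) (i≢x ∘ suc-injective))

∣S∣P≡∣row∣+∣row∣ : (S : PSub n m) {x x' : Fin n} → x ≢ x' → (∀ i → i ≢ x → i ≢ x' → lookup S i ≡ ⊥) →
                   ∣ S ∣P ≡ ∣ lookup S x ∣ + ∣ lookup S x' ∣
∣S∣P≡∣row∣+∣row∣ (r ∷ S) {zero}  {zero}   x≢x' _     = ⊥-elim (x≢x' refl)
∣S∣P≡∣row∣+∣row∣ (r ∷ S) {zero}  {suc x'} _    empty =
  cong (∣ r ∣ +_) (∣S∣P≡∣row∣ S x' λ i i≢x' → empty (suc i) (λ ()) (i≢x' ∘ suc-injective))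
∣S∣P≡∣row∣+∣row∣ (r ∷ S) {suc x} {zero}   _    empty =
  trans (cong (∣ r ∣ +_) (∣S∣P≡∣row∣ S x λ i i≢x → empty (suc i) (i≢x ∘ suc-injective) (λ ())))
        (ℕ.+-comm ∣ r ∣ _)
∣S∣P≡∣row∣+∣row∣ {m = m} (r ∷ S) {suc x} {suc x'} x≢x' empty =
  cong₂ _+_ (trans (cong ∣_∣ (empty zero (λ ()) (λ ()))) (∣⊥∣≡0 m))
            (∣S∣P≡∣row∣+∣row∣ S (x≢x' ∘ cong suc)
               λ i i≢x i≢x' → empty (suc i) (i≢x ∘ suc-injective) (i≢x' ∘ suc-injective))

∣e∣≤rank : (H : Hypergraph n) {e : Subset n} → e ∈E H → ∣ e ∣ ≤ rank H
∣e∣≤rank H = go (edges H)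
  where
  go : (es : List (Subset _)) {e : Subset _} → e List.∈ es → ∣ e ∣ ≤ foldr (λ e r → ∣ e ∣ ⊔ r) 0 es
  go (e ∷ es) (hereᴸ refl)  = ℕ.m≤m⊔n _ _
  go (_ ∷ es) (thereᴸ e∈es) = ℕ.≤-trans (go es e∈es) (ℕ.m≤n⊔m _ _)

m+n≤3⇒m≡1⊎n≡1 : {m n : ℕ} → 0 < m → 0 < n → m + n ≤ 3 → m ≡ 1 ⊎ n ≡ 1
m+n≤3⇒m≡1⊎n≡1 {1}           _ _ _ = inj₁ refl
m+n≤3⇒m≡1⊎n≡1 {suc (suc m)} {1} _ _ _ = inj₂ refl
m+n≤3⇒m≡1⊎n≡1 {suc (suc m)} {suc (suc n)} _ _ (s≤s (s≤s m+2+n≤1)) with ℕ.m+n≤o⇒n≤o m m+2+n≤1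
... | s≤s ()

tildeEdge : Fin n → Fin m → Subset n → Subset m → PSub n m
tildeEdge x y e f = ⁅ x , y ⁆P ∪P ((e ∖⁅ x ⁆) ×P (f ∖⁅ y ⁆))

module _ (x : Fin n) (y : Fin m) (e : Subset n) (f : Subset m) where

  private
    lookup-tildeEdge : (i : Fin n) → lookup (tildeEdge x y e f) i ≡
                       (if does (i ≟ x) then ⁅ y ⁆ else ⊥) ∪ (if lookup (e ∖⁅ x ⁆) i then f ∖⁅ y ⁆ else ⊥)
    lookup-tildeEdge i = trans (lookup-zipWith _∪_ i ⁅ x , y ⁆P ((e ∖⁅ x ⁆) ×P (f ∖⁅ y ⁆)))
      (cong₂ _∪_ (lookup∘tabulate (λ k → if does (k ≟ x) then ⁅ y ⁆ else ⊥) i)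
                 (lookup∘tabulate (λ k → if lookup (e ∖⁅ x ⁆) k then f ∖⁅ y ⁆ else ⊥) i))

  tildeEdge-row-x : lookup (tildeEdge x y e f) x ≡ ⁅ y ⁆
  tildeEdge-row-x = begin
    lookup (tildeEdge x y e f) x                                        ≡⟨ lookup-tildeEdge x ⟩
    (if does (x ≟ x) then ⁅ y ⁆ else ⊥) ∪ (if lookup (e ∖⁅ x ⁆) x then f ∖⁅ y ⁆ else ⊥)
      ≡⟨ cong₂ _∪_ (cong (if_then ⁅ y ⁆ else ⊥) (dec-true (x ≟ x) refl))
                   (cong (if_then f ∖⁅ y ⁆ else ⊥) (∉⇒lookup≡false x∉e∖x)) ⟩
    ⁅ y ⁆ ∪ ⊥                                                           ≡⟨ ∪-identityʳ ⁅ y ⁆ ⟩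
    ⁅ y ⁆                                                               ∎
    where
    open ≡-Reasoning
    x∉e∖x : x ∉ e ∖⁅ x ⁆
    x∉e∖x x∈e∖x = proj₂ (∈∖⁅⁆⁻ x∈e∖x) refl

  tildeEdge-row-≢ : {i : Fin n} → i ≢ x → lookup (tildeEdge x y e f) i ≡ (if lookup e i then f ∖⁅ y ⁆ else ⊥)
  tildeEdge-row-≢ {i} i≢x = begin
    lookup (tildeEdge x y e f) i                                        ≡⟨ lookup-tildeEdge i ⟩
    (if does (i ≟ x) then ⁅ y ⁆ else ⊥) ∪ (if lookup (e ∖⁅ x ⁆) i then f ∖⁅ y ⁆ else ⊥)
      ≡⟨ cong₂ _∪_ (cong (if_then ⁅ y ⁆ else ⊥) (dec-false (i ≟ x) i≢x))
                   (cong (if_then f ∖⁅ y ⁆ else ⊥) lookup-e∖x) ⟩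
    ⊥ ∪ (if lookup e i then f ∖⁅ y ⁆ else ⊥)                            ≡⟨ ∪-identityˡ _ ⟩
    (if lookup e i then f ∖⁅ y ⁆ else ⊥)                                ∎
    where
    open ≡-Reasoning
    lookup-e∖x : lookup (e ∖⁅ x ⁆) i ≡ lookup e i
    lookup-e∖x = begin
      lookup (e ∩ ∁ ⁅ x ⁆) i             ≡⟨ lookup-zipWith _∧_ i e (∁ ⁅ x ⁆) ⟩
      lookup e i ∧ lookup (∁ ⁅ x ⁆) i    ≡⟨ cong (lookup e i ∧_) (lookup-map i not ⁅ x ⁆) ⟩
      lookup e i ∧ not (lookup ⁅ x ⁆ i)  ≡⟨ cong (λ b → lookup e i ∧ not b) (∉⇒lookup≡false (x≢y⇒x∉⁅y⁆ i≢x)) ⟩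
      lookup e i ∧ true                  ≡⟨ ∧-identityʳ (lookup e i) ⟩
      lookup e i                         ∎

  tildeEdge⊆ : x ∈ e → y ∈ f → tildeEdge x y e f ⊆P (e ×P f)
  tildeEdge⊆ x∈e y∈f {i} {j} j∈row with i ≟ x
  ... | yes refl = ∈×P⁺ x∈e (subst (_∈ f) (sym (x∈⁅y⁆⇒x≡y y (subst (j ∈_) tildeEdge-row-x j∈row))) y∈f)
  ... | no  i≢x  = let e[i] , j∈f∖y = ∈-if⁻ (subst (j ∈_) (tildeEdge-row-≢ i≢x) j∈row)
                   in ∈×P⁺ (lookup⇒[]= i e e[i]) (proj₁ (∈∖⁅⁆⁻ j∈f∖y))

  p₁-tildeEdge : x ∈ e → y ∈ f → 2 ≤ ∣ f ∣ → p₁ (tildeEdge x y e f) ≡ e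
  p₁-tildeEdge x∈e y∈f 2≤∣f∣ = lookup-ext _ e λ i → trans (lookup-map i rowNonempty (tildeEdge x y e f)) (row i)
    where
    f∖y≢∅ : Nonempty (f ∖⁅ y ⁆)
    f∖y≢∅ = ∣p∣>0⇒Nonempty _ (ℕ.≤-pred (subst (2 ≤_) (∣p∣≡1+∣p∖x∣ y∈f) 2≤∣f∣))
    row : ∀ i → rowNonempty (lookup (tildeEdge x y e f) i) ≡ lookup e i
    row i with i ≟ x
    ... | yes refl = trans (cong rowNonempty tildeEdge-row-x)
                           (trans (rowNonempty⁺ (y , x∈⁅x⁆ y)) (sym ([]=⇒lookup x∈e)))
    ... | no  i≢x  = trans (cong rowNonempty (tildeEdge-row-≢ i≢x)) (rowNonempty-if f∖y≢∅ (lookup e i))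

  module _ (pair : Pair e x) where
    open Pair pair

    tildeEdge-row-other : lookup (tildeEdge x y e f) other ≡ f ∖⁅ y ⁆
    tildeEdge-row-other = trans (tildeEdge-row-≢ other≢x) (cong (if_then f ∖⁅ y ⁆ else ⊥) ([]=⇒lookup other∈p))

    tildeEdge-row-outside : {i : Fin n} → i ≢ x → i ≢ other → lookup (tildeEdge x y e f) i ≡ ⊥
    tildeEdge-row-outside i≢x i≢other =
      trans (tildeEdge-row-≢ i≢x) (cong (if_then f ∖⁅ y ⁆ else ⊥) (∉⇒lookup≡false (∉-pair i≢x i≢other)))

    p₂-tildeEdge : x ∈ e → y ∈ f → p₂ (tildeEdge x y e f) ≡ f
    p₂-tildeEdge x∈e y∈f = ⊆-antisym (p₂-⊆ {S = tildeEdge x y e f} e f (tildeEdge⊆ x∈e y∈f)) f⊆p₂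
      where
      f⊆p₂ : f ⊆ p₂ (tildeEdge x y e f)
      f⊆p₂ {j} j∈f with j ≟ y
      ... | yes refl = p₂⁺ (tildeEdge x y e f) x (subst (j ∈_) (sym tildeEdge-row-x) (x∈⁅x⁆ j))
      ... | no  j≢y  = p₂⁺ (tildeEdge x y e f) other (subst (j ∈_) (sym tildeEdge-row-other) (∈∖⁅⁆⁺ j∈f j≢y))

    ∣tildeEdge∣≡∣f∣ : y ∈ f → ∣ tildeEdge x y e f ∣P ≡ ∣ f ∣
    ∣tildeEdge∣≡∣f∣ y∈f = begin
      ∣ tildeEdge x y e f ∣P
        ≡⟨ ∣S∣P≡∣row∣+∣row∣ (tildeEdge x y e f) (other≢x ∘ sym) (λ _ → tildeEdge-row-outside) ⟩
      ∣ lookup (tildeEdge x y e f) x ∣ + ∣ lookup (tildeEdge x y e f) other ∣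
        ≡⟨ cong₂ _+_ (trans (cong ∣_∣ tildeEdge-row-x) (∣⁅x⁆∣≡1 y)) (cong ∣_∣ tildeEdge-row-other) ⟩
      suc ∣ f ∖⁅ y ⁆ ∣
        ≡⟨ sym (∣p∣≡1+∣p∖x∣ y∈f) ⟩
      ∣ f ∣ ∎
      where open ≡-Reasoning

singleton-row⇒≡tildeEdge :
  {S : PSub n m} {e : Subset n} {f : Subset m} {x : Fin n} {y : Fin m} (pair : Pair e x) →
  S ⊆P (e ×P f) → p₂ S ≡ f → ∣ S ∣P ≡ ∣ f ∣ → lookup S x ≡ ⁅ y ⁆ → y ∈ f →
  S ≡ tildeEdge x y e f
singleton-row⇒≡tildeEdge {S = S} {e} {f} {x} {y} pair S⊆e×f p₂S≡f ∣S∣≡∣f∣ row-x≡⁅y⁆ y∈f =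
  lookup-ext S _ row
  where
  open Pair pair
  row-outside-pair : {i : Fin _} → i ≢ x → i ≢ other → lookup S i ≡ ⊥
  row-outside-pair i≢x i≢other = row-outside {S = S} e f S⊆e×f (∉-pair i≢x i≢other)

  f∖y⊆row-other : f ∖⁅ y ⁆ ⊆ lookup S other
  f∖y⊆row-other {j} j∈f∖y with p₂⁻ S (subst (j ∈_) (sym p₂S≡f) (proj₁ (∈∖⁅⁆⁻ j∈f∖y)))
  ... | i , j∈S[i] with i ≟ x | i ≟ other
  ... | yes refl | _        = ⊥-elim (proj₂ (∈∖⁅⁆⁻ j∈f∖y) (x∈⁅y⁆⇒x≡y y (subst (j ∈_) row-x≡⁅y⁆ j∈S[i])))
  ... | no  _    | yes refl = j∈S[i]
  ... | no  i≢x  | no  i≢o  = ⊥-elim (∉⊥ (subst (j ∈_) (row-outside-pair i≢x i≢o) j∈S[i]))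

  ∣row-other∣≤∣f∖y∣ : ∣ lookup S other ∣ ≤ ∣ f ∖⁅ y ⁆ ∣
  ∣row-other∣≤∣f∖y∣ = ℕ.≤-reflexive (ℕ.suc-injective (begin
    suc ∣ lookup S other ∣                      ≡⟨ cong (_+ ∣ lookup S other ∣) (trans (sym (∣⁅x⁆∣≡1 y)) (cong ∣_∣ (sym row-x≡⁅y⁆))) ⟩
    ∣ lookup S x ∣ + ∣ lookup S other ∣         ≡⟨ sym (∣S∣P≡∣row∣+∣row∣ S (other≢x ∘ sym) (λ _ → row-outside-pair)) ⟩
    ∣ S ∣P                                      ≡⟨ ∣S∣≡∣f∣ ⟩
    ∣ f ∣                                       ≡⟨ ∣p∣≡1+∣p∖x∣ y∈f ⟩
    suc ∣ f ∖⁅ y ⁆ ∣                            ∎))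
    where open ≡-Reasoning

  row : ∀ i → lookup S i ≡ lookup (tildeEdge x y e f) i
  row i with i ≟ x | i ≟ other
  ... | yes refl | _        = trans row-x≡⁅y⁆ (sym (tildeEdge-row-x x y e f))
  ... | no  _    | yes refl = trans (sym (p⊆q∧∣q∣≤∣p∣⇒p≡q f∖y⊆row-other ∣row-other∣≤∣f∖y∣))
                                    (sym (tildeEdge-row-other x y e f pair))
  ... | no  i≢x  | no  i≢o  = trans (row-outside-pair i≢x i≢o) (sym (tildeEdge-row-outside x y e f pair i≢x i≢o))

module _ (G : Hypergraph n) (H : Hypergraph m) (simpleG : Simple G) (simpleH : Simple H) (rankG : rank G ≡ 2) where

  ∣e₁∣≡2 : {e₁ : Subset n} → e₁ ∈E G → ∣ e₁ ∣ ≡ 2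
  ∣e₁∣≡2 {e₁} e₁∈G = ℕ.≤-antisym (subst (∣ e₁ ∣ ≤_) rankG (∣e∣≤rank G e₁∈G)) (proj₁ simpleG e₁∈G)

  ∣e₁∣⊔∣e₂∣≡∣e₂∣ : {e₁ : Subset n} {e₂ : Subset m} → e₁ ∈E G → e₂ ∈E H → ∣ e₁ ∣ ⊔ ∣ e₂ ∣ ≡ ∣ e₂ ∣
  ∣e₁∣⊔∣e₂∣≡∣e₂∣ e₁∈G e₂∈H = ℕ.m≤n⇒m⊔n≡n (subst (_≤ _) (sym (∣e₁∣≡2 e₁∈G)) (proj₁ simpleH e₂∈H))

  tilde⇒hat : (e : PSub n m) → TildeEdge G H e → HatEdge G H e
  tilde⇒hat _ (e₁ , f , x , y , e₁∈G , f∈H , x∈e₁ , y∈f , refl) =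
    e₁ , f , e₁∈G , f∈H , tildeEdge⊆ x y e₁ f x∈e₁ y∈f
    , trans (∣tildeEdge∣≡∣f∣ x y e₁ f pair y∈f) (sym (∣e₁∣⊔∣e₂∣≡∣e₂∣ e₁∈G f∈H))
    , p₁-tildeEdge x y e₁ f x∈e₁ y∈f (proj₁ simpleH f∈H)
    , p₂-tildeEdge x y e₁ f pair x∈e₁ y∈f
    where
    pair : Pair e₁ x
    pair = ∣p∣≡2⇒Pair (∣e₁∣≡2 e₁∈G) x∈e₁

  hat⇒tilde : rank H ≤ 3 → (e : PSub n m) → HatEdge G H e → TildeEdge G H e
  hat⇒tilde rankH e (e₁ , e₂ , e₁∈G , e₂∈H , e⊆e₁×e₂ , ∣e∣≡ , p₁e≡e₁ , p₂e≡e₂) =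
    [ from-singleton-row x∈e₁ , from-singleton-row other∈p ]′
      (m+n≤3⇒m≡1⊎n≡1 (∣row∣>0 x∈e₁) (∣row∣>0 other∈p) ∣row-x∣+∣row-other∣≤3)
    where
    ∣e∣≡∣e₂∣ : ∣ e ∣P ≡ ∣ e₂ ∣
    ∣e∣≡∣e₂∣ = trans ∣e∣≡ (∣e₁∣⊔∣e₂∣≡∣e₂∣ e₁∈G e₂∈H)

    e₁≢∅ : Nonempty e₁
    e₁≢∅ = ∣p∣>0⇒Nonempty e₁ (subst (0 <_) (sym (∣e₁∣≡2 e₁∈G)) (s≤s z≤n))

    x : Fin _
    x = proj₁ e₁≢∅

    x∈e₁ : x ∈ e₁
    x∈e₁ = proj₂ e₁≢∅

    open Pair (∣p∣≡2⇒Pair (∣e₁∣≡2 e₁∈G) x∈e₁)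

    ∣row∣>0 : {i : Fin _} → i ∈ e₁ → 0 < ∣ lookup e i ∣
    ∣row∣>0 {i} i∈e₁ = Nonempty⇒∣p∣>0 (rowNonempty⁻ (lookup e i) (begin
      rowNonempty (lookup e i) ≡⟨ lookup-map i rowNonempty e ⟨
      lookup (p₁ e) i          ≡⟨ cong (λ s → lookup s i) p₁e≡e₁ ⟩
      lookup e₁ i              ≡⟨ []=⇒lookup i∈e₁ ⟩
      true                     ∎))
      where open ≡-Reasoning

    ∣row-x∣+∣row-other∣≤3 : ∣ lookup e x ∣ + ∣ lookup e other ∣ ≤ 3
    ∣row-x∣+∣row-other∣≤3 =
      subst (_≤ 3) (trans (sym ∣e∣≡∣e₂∣) (∣S∣P≡∣row∣+∣row∣ e (other≢x ∘ sym)
                                            λ _ i≢x i≢o → row-outside {S = e} e₁ e₂ e⊆e₁×e₂ (∉-pair i≢x i≢o)))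
            (ℕ.≤-trans (∣e∣≤rank H e₂∈H) rankH)

    from-singleton-row : {z : Fin _} → z ∈ e₁ → ∣ lookup e z ∣ ≡ 1 → TildeEdge G H e
    from-singleton-row {z} z∈e₁ ∣row-z∣≡1 =
      e₁ , e₂ , z , y , e₁∈G , e₂∈H , z∈e₁ , y∈e₂
      , singleton-row⇒≡tildeEdge (∣p∣≡2⇒Pair (∣e₁∣≡2 e₁∈G) z∈e₁) e⊆e₁×e₂ p₂e≡e₂ ∣e∣≡∣e₂∣ row-z≡⁅y⁆ y∈e₂
      where
      y : Fin _
      y = proj₁ (∣p∣≡1⇒singleton (lookup e z) ∣row-z∣≡1)
      row-z≡⁅y⁆ : lookup e z ≡ ⁅ y ⁆
      row-z≡⁅y⁆ = proj₂ (∣p∣≡1⇒singleton (lookup e z) ∣row-z∣≡1)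
      y∈e₂ : y ∈ e₂
      y∈e₂ = proj₂ (∈×P⁻ e₁ e₂ (e⊆e₁×e₂ {z} (subst (y ∈_) (sym row-z≡⁅y⁆) (x∈⁅x⁆ y))))

lemma3p1 : {n m : ℕ} (G : Hypergraph n) (H : Hypergraph m) →
    Simple G → Simple H → rank G ≡ 2 → rank H ≤ 3 →
    (e : PSub n m) → (HatEdge G H e → TildeEdge G H e) × (TildeEdge G H e → HatEdge G H e)
lemma3p1 G H simpleG simpleH rankG rankH e =
  hat⇒tilde G H simpleG simpleH rankG rankH e , tilde⇒hat G H simpleG simpleH rankG e
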